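{- Let $G=(V,E)$ be a finite simple directed graph that is transitive and acyclic. Then a set $M\subseteq V$ is a strong module of $G$ if and only if $M$ is a strong module of the undirected closure $\mathcal{U}(G)=(V,E\cup E^{ -1})$, where $E^{ -1}=\{(b,a)\mid (a,b)\in E\}$.
   Context: All graphs are simple (no loops, no multiple edges) and directed; an undirected graph is a directed graph with $E=E^{ -1}$ (each undirected edge is a pair of opposite arcs). A graph $G=(V,E)$ is transitive iff for all $(a,b),(b,c)\in E$ with $a\neq c$ we have $(a,c)\in E$. A module of $G$ is a non-empty set $M\subseteq V$ such that every vertex $x\in V\setminus M$ has the same relationship to all vertices of $M$, i.e. for all $m,m'\in M$: $(x,m)\in E\iff(x,m')\in E$ and $(m,x)\in E\iff(m',x)\in E$. Two modules overlap if they intersect but neither contains the other. A module is strong if it overlaps with no module of the same graph. -}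

module Defs where

open import Data.Nat using (ℕ)
open import Data.Fin using (Fin)
open import Data.Fin.Subset using (Subset; _∈_; _∉_; _⊆_; Nonempty)
open import Data.Product using (_×_; ∃)
open import Data.Sum using (_⊎_)
open import Data.Empty using (⊥)
open import Relation.Nullary using (¬_)
open import Relation.Binary.PropositionalEquality using (_≡_; _≢_)
open import Relation.Binary.Construct.Closure.Transitive using (TransClosure)
open import Function.Bundles using (_⇔_)

Graph : ℕ → Set₁
Graph n = Fin n → Fin n → Set

module _ {n : ℕ} (E : Graph n) where

  -- simple: no loops (multiple edges are impossible for a relation)
  Loopless : Set
  Loopless = ∀ x → ¬ E x x

  Transitive : Set
  Transitive = ∀ a b c → E a b → E b c → a ≢ c → E a c

  Acyclic : Set
  Acyclic = ∀ x → ¬ TransClosure E x x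

  IsModule : Subset n → Set
  IsModule M = Nonempty M ×
    (∀ x m m' → x ∉ M → m ∈ M → m' ∈ M →
       (E x m ⇔ E x m') × (E m x ⇔ E m' x))

  Overlap : Subset n → Subset n → Set
  Overlap A B = (∃ λ v → v ∈ A × v ∈ B) × ¬ (A ⊆ B) × ¬ (B ⊆ A)

  IsStrongModule : Subset n → Set
  IsStrongModule M = IsModule M × (∀ M' → IsModule M' → ¬ Overlap M M')

UndirectedClosure : ∀ {n} → Graph n → Graph n
UndirectedClosure E a b = E a b ⊎ E b a

module Submission where

open import Defs
open import Level using (0ℓ)
open import Data.Nat using (ℕ)
open import Data.Fin using (Fin)
open import Data.Fin.Subset using (Subset; _∈_; _∉_; _⊆_; Nonempty)
open import Data.Fin.Subset.Properties using (_∈?_)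
open import Data.Fin.Properties using (any?; all?; ¬∀⟶∃¬)
open import Data.Vec using (tabulate)
open import Data.Vec.Properties using (lookup∘tabulate; []=⇒lookup; lookup⇒[]=)
open import Data.Bool.Properties using (T-≡)
open import Data.List using ([]; _∷_; filter; allFin)
open import Data.List.Membership.Propositional using () renaming (_∈_ to _∈ₗ_)
open import Data.List.Membership.Propositional.Properties using (∈-allFin; ∈-filter⁺; ∈-filter⁻)
open import Data.List.Relation.Unary.Any using (here; there)
open import Data.Product using (_×_; _,_; proj₁; proj₂; ∃; swap)
open import Data.Sum as Sum using (_⊎_; inj₁; inj₂; [_,_]′)
open import Data.Empty using (⊥-elim)
open import Relation.Unary using (Pred)
open import Relation.Nullary using (¬_; Dec; yes; no)
open import Relation.Nullary.Decidable
  using (isYes; toWitness; fromWitness; decidable-stable; ¬?; _×-dec_; _⊎-dec_; _→-dec_)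
open import Relation.Binary.PropositionalEquality using (refl; sym; trans)
open import Relation.Binary.Definitions using (Decidable; Asymmetric)
open import Relation.Binary.Construct.Closure.Transitive using ([_]; _∷_)
open import Function using (_∘_; flip; const)
open import Function.Bundles using (_⇔_; mk⇔; Equivalence)

-- G is a strict order and every module of G is a module of U(G), so it suffices to turn a
-- module of one graph overlapping M into a module of the other graph overlapping M.
--
-- If a module M of U(G) is not a module of G, some x ∉ M lies below a ∈ M and above b ∈ M.
-- The members of M above x, together with the vertices outside M that are placed relative to M
-- exactly as x is, form a module of U(G) that overlaps M (it contains a and x but not b).
--
-- Conversely, let M be a module of G and M' an overlapping module of U(G), with i ∈ M ∩ M',
-- r ∈ M ∖ M' and d ∈ M' ∖ M. The convex hull of a module of U(G) is a module of G. If d and i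
-- are incomparable, no vertex of M' is comparable with r, and the hull of M' overlaps M. If, say,
-- i < d, then all of M lies below d; splitting M by M' and keeping the side X that avoids a
-- minimal element m of M, the hull of X ∪ {v ∈ M' ∖ M | i < v} overlaps M: it contains d but
-- not m, as nothing in that set lies below m. The case d < i is the same argument in the dual order.

module _ {n : ℕ} {P : Pred (Fin n) 0ℓ} (P? : ∀ v → Dec (P v)) where

  subset : Subset n
  subset = tabulate (isYes ∘ P?)

  ∈-subset⁺ : ∀ {v} → P v → v ∈ subset
  ∈-subset⁺ {v} p =
    lookup⇒[]= v subset (trans (lookup∘tabulate _ v) (Equivalence.to T-≡ (fromWitness p)))

  ∈-subset⁻ : ∀ {v} → v ∈ subset → P v
  ∈-subset⁻ {v} v∈ =
    toWitness (Equivalence.from T-≡ (trans (sym (lookup∘tabulate _ v)) ([]=⇒lookup v∈)))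

⊈-witness : ∀ {n} {A B : Subset n} → ¬ A ⊆ B → ∃ λ v → v ∈ A × v ∉ B
⊈-witness {n} {A} {B} A⊈B
  with ¬∀⟶∃¬ n (λ v → v ∈ A → v ∈ B) (λ v → v ∈? A →-dec v ∈? B) (λ A⊆B → A⊈B (A⊆B _))
... | v , v∉ = v , decidable-stable (v ∈? A) (λ v∉A → v∉ (⊥-elim ∘ v∉A)) , v∉ ∘ const

module _ {n : ℕ} {E : Graph n} {M : Subset n} (M-mod : IsModule E M) where

  uniformˡ : ∀ {x m m'} → x ∉ M → m ∈ M → m' ∈ M → E x m → E x m'
  uniformˡ x∉ m∈ m'∈ = Equivalence.to (proj₁ (proj₂ M-mod _ _ _ x∉ m∈ m'∈))

  uniformʳ : ∀ {x m m'} → x ∉ M → m ∈ M → m' ∈ M → E m x → E m' x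
  uniformʳ x∉ m∈ m'∈ = Equivalence.to (proj₂ (proj₂ M-mod _ _ _ x∉ m∈ m'∈))

  module-flip : IsModule (flip E) M
  module-flip = proj₁ M-mod , λ x m m' x∉ m∈ m'∈ → swap (proj₂ M-mod x m m' x∉ m∈ m'∈)

module Closure {n : ℕ} (E : Graph n) where

  infix 4 _~_
  _~_ : Fin n → Fin n → Set
  _~_ = UndirectedClosure E

  ~-sym : ∀ {a b} → a ~ b → b ~ a
  ~-sym = Sum.swap

  ~-module : ∀ {S} → Nonempty S →
    (∀ {x m m'} → x ∉ S → m ∈ S → m' ∈ S → x ~ m → x ~ m') → IsModule _~_ S
  ~-module ne uniform = ne , λ x m m' x∉ m∈ m'∈ →
    mk⇔ (uniform x∉ m∈ m'∈) (uniform x∉ m'∈ m∈) ,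
    mk⇔ (~-sym ∘ uniform x∉ m∈ m'∈ ∘ ~-sym) (~-sym ∘ uniform x∉ m'∈ m∈ ∘ ~-sym)

  module⇒~-module : ∀ {S} → IsModule E S → IsModule _~_ S
  module⇒~-module S-mod = ~-module (proj₁ S-mod) λ x∉ m∈ m'∈ →
    Sum.map (uniformˡ S-mod x∉ m∈ m'∈) (uniformʳ S-mod x∉ m∈ m'∈)

  all-or-none⇒~-module : ∀ {S} → Nonempty S →
    (∀ {w} → w ∉ S → (∀ {s} → s ∈ S → w ~ s) ⊎ (∀ {s} → s ∈ S → ¬ w ~ s)) →
    IsModule _~_ S
  all-or-none⇒~-module ne all-or-none = ~-module ne λ x∉ m∈ m'∈ x~m →
    [ (λ all → all m'∈) , (λ none → ⊥-elim (none m∈ x~m)) ]′ (all-or-none x∉)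

  unmixed-~-module⇒module : ∀ {S} → IsModule _~_ S →
    (∀ {x a b} → x ∉ S → a ∈ S → b ∈ S → E x a → ¬ E b x) → IsModule E S
  unmixed-~-module⇒module {S} S~ unmixed = proj₁ S~ , λ x m m' x∉ m∈ m'∈ →
    mk⇔ (out x∉ m∈ m'∈) (out x∉ m'∈ m∈) , mk⇔ (into x∉ m∈ m'∈) (into x∉ m'∈ m∈)
    where
    out : ∀ {x m m'} → x ∉ S → m ∈ S → m' ∈ S → E x m → E x m'
    out x∉ m∈ m'∈ xm = [ (λ xm' → xm') , (λ m'x → ⊥-elim (unmixed x∉ m∈ m'∈ xm m'x)) ]′
                         (uniformˡ S~ x∉ m∈ m'∈ (inj₁ xm))
    into : ∀ {x m m'} → x ∉ S → m ∈ S → m' ∈ S → E m x → E m' x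
    into x∉ m∈ m'∈ mx = [ (λ xm' → ⊥-elim (unmixed x∉ m'∈ m∈ xm' mx)) , (λ m'x → m'x) ]′
                          (uniformˡ S~ x∉ m∈ m'∈ (inj₂ mx))

  overlap-adjacent : ∀ {M M' r₀ d₀} → IsModule _~_ M → IsModule _~_ M' →
    r₀ ∈ M → d₀ ∈ M' → d₀ ∉ M → r₀ ~ d₀ →
    ∀ {r s} → r ∈ M → r ∉ M' → s ∈ M' → r ~ s
  overlap-adjacent M~ M'~ r₀∈ d₀∈ d₀∉ r₀~d₀ r∈ r∉ s∈ =
    uniformˡ M'~ r∉ d₀∈ s∈ (~-sym (uniformˡ M~ d₀∉ r₀∈ r∈ (~-sym r₀~d₀)))

module StrictOrder {n : ℕ} (_<_ : Graph n) (_<?_ : Decidable _<_)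
                   (<-asym : Asymmetric _<_) (<-trans′ : Transitive _<_) where

  open Closure _<_

  <-irrefl : ∀ {a} → ¬ a < a
  <-irrefl a<a = <-asym a<a a<a

  <-trans : ∀ {a b c} → a < b → b < c → a < c
  <-trans {a} {b} {c} a<b b<c = <-trans′ a b c a<b b<c λ { refl → <-asym a<b b<c }

  _~?_ : Decidable _~_
  a ~? b = a <? b ⊎-dec b <? a

  Uniform : Subset n → Fin n → Set
  Uniform S w = (∀ {s} → s ∈ S → w < s) ⊎ (∀ {s} → s ∈ S → s < w) ⊎ (∀ {s} → s ∈ S → ¬ w ~ s)

  uniform⇒module : ∀ {S} → Nonempty S → (∀ {w} → w ∉ S → Uniform S w) → IsModule _<_ S
  uniform⇒module {S} ne uniform = ne , λ x m m' x∉ m∈ m'∈ → related (uniform x∉) m∈ m'∈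
    where
    both : ∀ {A B : Set} → A → B → A ⇔ B
    both a b = mk⇔ (const b) (const a)
    neither : ∀ {A B : Set} → ¬ A → ¬ B → A ⇔ B
    neither ¬a ¬b = mk⇔ (⊥-elim ∘ ¬a) (⊥-elim ∘ ¬b)
    related : ∀ {x m m'} → Uniform S x → m ∈ S → m' ∈ S →
      (x < m ⇔ x < m') × (m < x ⇔ m' < x)
    related (inj₁ below) m∈ m'∈ =
      both (below m∈) (below m'∈) , neither (<-asym (below m∈)) (<-asym (below m'∈))
    related (inj₂ (inj₁ above)) m∈ m'∈ =
      neither (<-asym (above m∈)) (<-asym (above m'∈)) , both (above m∈) (above m'∈)
    related (inj₂ (inj₂ apart)) m∈ m'∈ =
      neither (apart m∈ ∘ inj₁) (apart m'∈ ∘ inj₁) , neither (apart m∈ ∘ inj₂) (apart m'∈ ∘ inj₂)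

  minimal : ∀ {v xs} → v ∈ₗ xs → ∃ λ m → m ∈ₗ xs × (∀ {y} → y ∈ₗ xs → ¬ y < m)
  minimal {xs = x ∷ []} _ = x , here refl , λ { (here refl) → <-irrefl }
  minimal {xs = x ∷ x' ∷ xs} _ with minimal {xs = x' ∷ xs} (here refl)
  ... | m , m∈ , m-min with x <? m
  ...   | yes x<m = x , here refl , λ { (here refl) → <-irrefl
                                       ; (there y∈) y<x → m-min y∈ (<-trans y<x x<m) }
  ...   | no x≮m = m , there m∈ , λ { (here refl) → x≮m ; (there y∈) → m-min y∈ }

  ∃-minimal : ∀ {M} → Nonempty M → ∃ λ m → m ∈ M × (∀ {y} → y ∈ M → ¬ y < m)
  ∃-minimal {M} (v , v∈M) with minimal (∈-filter⁺ (_∈? M) (∈-allFin v) v∈M)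
  ... | m , m∈ , m-min =
    m , proj₂ (∈-filter⁻ (_∈? M) {xs = allFin n} m∈) ,
    λ {y} y∈M → m-min (∈-filter⁺ (_∈? M) (∈-allFin y) y∈M)

  Between : Subset n → Fin n → Set
  Between S v = (∃ λ a → a ∈ S × a < v) × (∃ λ b → b ∈ S × v < b)

  between? : ∀ S v → Dec (Between S v)
  between? S v = any? (λ a → a ∈? S ×-dec a <? v) ×-dec any? (λ b → b ∈? S ×-dec v <? b)

  hull : Subset n → Subset n
  hull S = subset λ v → v ∈? S ⊎-dec between? S v

  ⊆-hull : ∀ {S} → S ⊆ hull S
  ⊆-hull = ∈-subset⁺ _ ∘ inj₁

  between⇒∈-hull : ∀ {S v} → Between S v → v ∈ hull S
  between⇒∈-hull = ∈-subset⁺ _ ∘ inj₂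

  ∉-hull : ∀ {S v} → v ∉ S → ¬ Between S v → v ∉ hull S
  ∉-hull v∉ not-between v∈ = [ v∉ , not-between ]′ (∈-subset⁻ _ v∈)

  below-hull : ∀ {S w} → (∀ {s} → s ∈ S → w < s) → ∀ {v} → v ∈ hull S → w < v
  below-hull below v∈ with ∈-subset⁻ _ v∈
  ... | inj₁ v∈S = below v∈S
  ... | inj₂ ((a , a∈ , a<v) , _) = <-trans (below a∈) a<v

  above-hull : ∀ {S w} → (∀ {s} → s ∈ S → s < w) → ∀ {v} → v ∈ hull S → v < w
  above-hull above v∈ with ∈-subset⁻ _ v∈
  ... | inj₁ v∈S = above v∈S
  ... | inj₂ (_ , (b , b∈ , v<b)) = <-trans v<b (above b∈)

  apart-hull : ∀ {S w} → (∀ {s} → s ∈ S → ¬ w ~ s) → ∀ {v} → v ∈ hull S → ¬ w ~ v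
  apart-hull apart v∈ w~v with ∈-subset⁻ _ v∈ | w~v
  ... | inj₁ v∈S | _ = apart v∈S w~v
  ... | inj₂ (_ , (b , b∈ , v<b)) | inj₁ w<v = apart b∈ (inj₁ (<-trans w<v v<b))
  ... | inj₂ ((a , a∈ , a<v) , _) | inj₂ v<w = apart a∈ (inj₂ (<-trans a<v v<w))

  hull-module : ∀ {S} → IsModule _~_ S → IsModule _<_ (hull S)
  hull-module {S} S~ with proj₁ S~
  ... | s₀ , s₀∈ = uniform⇒module (s₀ , ⊆-hull s₀∈) uniform
    where
    uniform : ∀ {w} → w ∉ hull S → Uniform (hull S) w
    uniform {w} w∉ with w <? s₀ | s₀ <? w
    ... | yes w<s₀ | _ = inj₁ (below-hull below)
      where
      below : ∀ {s} → s ∈ S → w < s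
      below s∈ with uniformˡ S~ (w∉ ∘ ⊆-hull) s₀∈ s∈ (inj₁ w<s₀)
      ... | inj₁ w<s = w<s
      ... | inj₂ s<w = ⊥-elim (w∉ (between⇒∈-hull ((_ , s∈ , s<w) , (s₀ , s₀∈ , w<s₀))))
    ... | no _ | yes s₀<w = inj₂ (inj₁ (above-hull above))
      where
      above : ∀ {s} → s ∈ S → s < w
      above s∈ with uniformˡ S~ (w∉ ∘ ⊆-hull) s₀∈ s∈ (inj₂ s₀<w)
      ... | inj₂ s<w = s<w
      ... | inj₁ w<s = ⊥-elim (w∉ (between⇒∈-hull ((s₀ , s₀∈ , s₀<w) , (_ , s∈ , w<s))))
    ... | no w≮s₀ | no s₀≮w = inj₂ (inj₂ (apart-hull apart))
      where
      apart : ∀ {s} → s ∈ S → ¬ w ~ s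
      apart s∈ w~s = [ w≮s₀ , s₀≮w ]′ (uniformˡ S~ (w∉ ∘ ⊆-hull) s∈ s₀∈ w~s)

  module Overlapping {M M' : Subset n} (M-mod : IsModule _<_ M) (M'~ : IsModule _~_ M')
                     {i₀ r₀ d₀ : Fin n} (i₀∈M : i₀ ∈ M) (i₀∈M' : i₀ ∈ M')
                     (r₀∈M : r₀ ∈ M) (r₀∉M' : r₀ ∉ M') (d₀∈M' : d₀ ∈ M') (d₀∉M : d₀ ∉ M) where

    private
      M~ : IsModule _~_ M
      M~ = module⇒~-module M-mod

    apart⇒hull-overlaps : ¬ d₀ ~ i₀ → Overlap _<_ M (hull M')
    apart⇒hull-overlaps d₀≁i₀ =
      (i₀ , i₀∈M , ⊆-hull i₀∈M') ,
      (λ M⊆ → ∉-hull r₀∉M' (λ ((a , a∈ , a<r₀) , _) → r₀≁M' a∈ (inj₂ a<r₀)) (M⊆ r₀∈M)) ,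
      (λ hull⊆ → d₀∉M (hull⊆ (⊆-hull d₀∈M')))
      where
      r₀≁M' : ∀ {s} → s ∈ M' → ¬ r₀ ~ s
      r₀≁M' s∈ r₀~s =
        d₀≁i₀ (uniformˡ M~ d₀∉M r₀∈M i₀∈M (~-sym (uniformˡ M'~ r₀∉M' s∈ d₀∈M' r₀~s)))

    module _ (i₀<d₀ : i₀ < d₀) where

      private
        d₀~r₀ : d₀ ~ r₀
        d₀~r₀ = uniformˡ M~ d₀∉M i₀∈M r₀∈M (inj₂ i₀<d₀)

        M'∖M~M : ∀ {d m} → d ∈ M' → d ∉ M → m ∈ M → d ~ m
        M'∖M~M = overlap-adjacent M'~ M~ d₀∈M' r₀∈M r₀∉M' d₀~r₀

        M∖M'~M' : ∀ {r s} → r ∈ M → r ∉ M' → s ∈ M' → r ~ s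
        M∖M'~M' = overlap-adjacent M~ M'~ r₀∈M d₀∈M' d₀∉M (~-sym d₀~r₀)

        Raised : Fin n → Set
        Raised v = v ∈ M' × v ∉ M × i₀ < v

      split⇒overlap : {X : Pred (Fin n) 0ℓ} (X? : ∀ v → Dec (X v)) →
        (∀ {a b} → a ∈ M → b ∈ M → X a → ¬ X b → a ~ b) →
        (∃ λ v → v ∈ M × X v) →
        ∀ {m₀} → m₀ ∈ M → ¬ X m₀ → (∀ {y} → y ∈ M → ¬ y < m₀) →
        ∃ λ N → IsModule _<_ N × Overlap _<_ M N
      split⇒overlap {X} X? cross (v , v∈M , Xv) {m₀} m₀∈M ¬Xm₀ m₀-min =
        hull S , hull-module S~ ,
        (v , v∈M , ⊆-hull (∈-subset⁺ S? (inj₁ (v∈M , Xv)))) ,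
        (λ M⊆ → ∉-hull m₀∉S m₀-not-between (M⊆ m₀∈M)) ,
        (λ hull⊆ → d₀∉M (hull⊆ (⊆-hull d₀∈S)))
        where
        Member : Fin n → Set
        Member v = (v ∈ M × X v) ⊎ Raised v

        S? : ∀ v → Dec (Member v)
        S? v = (v ∈? M ×-dec X? v) ⊎-dec (v ∈? M' ×-dec ¬? (v ∈? M) ×-dec i₀ <? v)

        S : Subset n
        S = subset S?

        d₀∈S : d₀ ∈ S
        d₀∈S = ∈-subset⁺ S? (inj₂ (d₀∈M' , d₀∉M , i₀<d₀))

        m₀∉S : m₀ ∉ S
        m₀∉S m₀∈ = [ ¬Xm₀ ∘ proj₂ , (λ (_ , m₀∉M , _) → m₀∉M m₀∈M) ]′ (∈-subset⁻ S? m₀∈)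

        m₀-not-between : ¬ Between S m₀
        m₀-not-between ((a , a∈ , a<m₀) , _) with ∈-subset⁻ S? a∈
        ... | inj₁ (a∈M , _) = m₀-min a∈M a<m₀
        ... | inj₂ (_ , a∉M , i₀<a) = <-asym a<m₀ (uniformʳ M-mod a∉M i₀∈M m₀∈M i₀<a)

        all-or-none : ∀ {w} → w ∉ S → (∀ {s} → s ∈ S → w ~ s) ⊎ (∀ {s} → s ∈ S → ¬ w ~ s)
        all-or-none {w} w∉ with w ∈? M | w ∈? M'
        ... | yes w∈M | _ = inj₁ λ s∈ → adjacent (∈-subset⁻ S? s∈)
          where
          adjacent : ∀ {s} → Member s → w ~ s
          adjacent (inj₁ (s∈M , Xs)) = ~-sym (cross s∈M w∈M Xs (w∉ ∘ ∈-subset⁺ S? ∘ inj₁ ∘ (w∈M ,_)))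
          adjacent (inj₂ (s∈M' , s∉M , _)) = ~-sym (M'∖M~M s∈M' s∉M w∈M)
        ... | no w∉M | yes w∈M' = inj₁ λ s∈ → adjacent (∈-subset⁻ S? s∈)
          where
          w<i₀ : w < i₀
          w<i₀ with M'∖M~M w∈M' w∉M i₀∈M
          ... | inj₁ w<i₀ = w<i₀
          ... | inj₂ i₀<w = ⊥-elim (w∉ (∈-subset⁺ S? (inj₂ (w∈M' , w∉M , i₀<w))))
          adjacent : ∀ {s} → Member s → w ~ s
          adjacent (inj₁ (s∈M , _)) = M'∖M~M w∈M' w∉M s∈M
          adjacent (inj₂ (_ , _ , i₀<s)) = inj₁ (<-trans w<i₀ i₀<s)
        ... | no w∉M | no w∉M' with w ~? i₀
        ...   | yes w~i₀ = inj₁ λ s∈ → adjacent (∈-subset⁻ S? s∈)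
          where
          adjacent : ∀ {s} → Member s → w ~ s
          adjacent (inj₁ (s∈M , _)) = uniformˡ M~ w∉M i₀∈M s∈M w~i₀
          adjacent (inj₂ (s∈M' , _)) = uniformˡ M'~ w∉M' i₀∈M' s∈M' w~i₀
        ...   | no w≁i₀ = inj₂ λ s∈ → apart (∈-subset⁻ S? s∈)
          where
          apart : ∀ {s} → Member s → ¬ w ~ s
          apart (inj₁ (s∈M , _)) = w≁i₀ ∘ uniformˡ M~ w∉M s∈M i₀∈M
          apart (inj₂ (s∈M' , _)) = w≁i₀ ∘ uniformˡ M'~ w∉M' s∈M' i₀∈M'

        S~ : IsModule _~_ S
        S~ = all-or-none⇒~-module (d₀ , d₀∈S) all-or-none

      below⇒overlap : ∃ λ N → IsModule _<_ N × Overlap _<_ M N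
      below⇒overlap with ∃-minimal (i₀ , i₀∈M)
      ... | m₀ , m₀∈M , m₀-min with m₀ ∈? M'
      ...   | yes m₀∈M' =
        split⇒overlap (¬? ∘ (_∈? M'))
          (λ a∈ _ a∉M' b∈M' → M∖M'~M' a∈ a∉M' (decidable-stable (_ ∈? M') b∈M'))
          (r₀ , r₀∈M , r₀∉M') m₀∈M (λ m₀∉M' → m₀∉M' m₀∈M') m₀-min
      ...   | no m₀∉M' =
        split⇒overlap (_∈? M')
          (λ _ b∈ a∈M' b∉M' → ~-sym (M∖M'~M' b∈ b∉M' a∈M'))
          (i₀ , i₀∈M , i₀∈M') m₀∈M m₀∉M' m₀-min

  mixed⇒overlap : ∀ {M x a₀ b₀} → IsModule _~_ M → x ∉ M → a₀ ∈ M → b₀ ∈ M →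
    x < a₀ → b₀ < x → ∃ λ N → IsModule _~_ N × Overlap _~_ M N
  mixed⇒overlap {M} {x} {a₀} {b₀} M~ x∉M a₀∈M b₀∈M x<a₀ b₀<x =
    N , N~ , (a₀ , a₀∈M , a₀∈N) , (λ M⊆ → b₀∉N (M⊆ b₀∈M)) , (λ N⊆ → x∉M (N⊆ x∈N))
    where
    Mimics : Fin n → Fin n → Set
    Mimics v m = m ∈ M → (x < m → v < m) × (m < x → m < v)

    mimics? : ∀ v m → Dec (Mimics v m)
    mimics? v m = m ∈? M →-dec ((x <? m →-dec v <? m) ×-dec (m <? x →-dec m <? v))

    Member : Fin n → Set
    Member v = (v ∈ M × x < v) ⊎ (v ∉ M × ∀ m → Mimics v m)

    N? : ∀ v → Dec (Member v)
    N? v = (v ∈? M ×-dec x <? v) ⊎-dec (¬? (v ∈? M) ×-dec all? (mimics? v))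

    N : Subset n
    N = subset N?

    a₀∈N : a₀ ∈ N
    a₀∈N = ∈-subset⁺ N? (inj₁ (a₀∈M , x<a₀))

    x∈N : x ∈ N
    x∈N = ∈-subset⁺ N? (inj₂ (x∉M , λ _ _ → (λ x<m → x<m) , (λ m<x → m<x)))

    b₀∉N : b₀ ∉ N
    b₀∉N b₀∈ =
      [ (λ (_ , x<b₀) → <-asym x<b₀ b₀<x) , (λ (b₀∉M , _) → b₀∉M b₀∈M) ]′ (∈-subset⁻ N? b₀∈)

    x~M : ∀ {m} → m ∈ M → x ~ m
    x~M m∈ = uniformˡ M~ x∉M a₀∈M m∈ (inj₁ x<a₀)

    violation : ∀ {w m} → ¬ Mimics w m → m ∈ M → w ~ m → (x < m × m < w) ⊎ (m < x × w < m)
    violation ¬mimics m∈ w~m with x~M m∈ | w~m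
    ... | inj₁ x<m | inj₂ m<w = inj₁ (x<m , m<w)
    ... | inj₂ m<x | inj₁ w<m = inj₂ (m<x , w<m)
    ... | inj₁ x<m | inj₁ w<m = ⊥-elim (¬mimics λ _ → const w<m , ⊥-elim ∘ <-asym x<m)
    ... | inj₂ m<x | inj₂ m<w = ⊥-elim (¬mimics λ _ → ⊥-elim ∘ flip <-asym m<x , const m<w)

    all-or-none : ∀ {w} → w ∉ N → (∀ {s} → s ∈ N → w ~ s) ⊎ (∀ {s} → s ∈ N → ¬ w ~ s)
    all-or-none {w} w∉ with w ∈? M
    ... | yes w∈M = inj₁ λ s∈ → adjacent (∈-subset⁻ N? s∈)
      where
      w<x : w < x
      w<x with x~M w∈M
      ... | inj₁ x<w = ⊥-elim (w∉ (∈-subset⁺ N? (inj₁ (w∈M , x<w))))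
      ... | inj₂ w<x = w<x
      adjacent : ∀ {s} → Member s → w ~ s
      adjacent (inj₁ (_ , x<s)) = inj₁ (<-trans w<x x<s)
      adjacent (inj₂ (_ , mimics)) = inj₁ (proj₂ (mimics w w∈M) w<x)
    ... | no w∉M with w ~? a₀
    ...   | no w≁a₀ = inj₂ λ s∈ → apart (∈-subset⁻ N? s∈)
      where
      apart : ∀ {s} → Member s → ¬ w ~ s
      apart (inj₁ (s∈M , _)) = w≁a₀ ∘ uniformˡ M~ w∉M s∈M a₀∈M
      apart (inj₂ (_ , mimics)) (inj₁ w<s) =
        w≁a₀ (inj₁ (<-trans w<s (proj₁ (mimics a₀ a₀∈M) x<a₀)))
      apart (inj₂ (_ , mimics)) (inj₂ s<w) =
        w≁a₀ (uniformˡ M~ w∉M b₀∈M a₀∈M (inj₂ (<-trans (proj₂ (mimics b₀ b₀∈M) b₀<x) s<w)))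
    ...   | yes w~a₀ with ¬∀⟶∃¬ n (Mimics w) (mimics? w) (w∉ ∘ ∈-subset⁺ N? ∘ inj₂ ∘ (w∉M ,_))
    ...     | m , ¬mimics = inj₁ λ s∈ → adjacent (∈-subset⁻ N? s∈)
      where
      m∈M : m ∈ M
      m∈M = decidable-stable (m ∈? M) (λ m∉M → ¬mimics (⊥-elim ∘ m∉M))
      adjacent : ∀ {s} → Member s → w ~ s
      adjacent (inj₁ (s∈M , _)) = uniformˡ M~ w∉M a₀∈M s∈M w~a₀
      adjacent (inj₂ (_ , mimics)) with violation ¬mimics m∈M (uniformˡ M~ w∉M a₀∈M m∈M w~a₀)
      ... | inj₁ (x<m , m<w) = inj₂ (<-trans (proj₁ (mimics m m∈M) x<m) m<w)
      ... | inj₂ (m<x , w<m) = inj₁ (<-trans w<m (proj₂ (mimics m m∈M) m<x))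

    N~ : IsModule _~_ N
    N~ = all-or-none⇒~-module (a₀ , a₀∈N) all-or-none

module Comparability {n : ℕ} {E : Graph n} (E? : Decidable E)
                     (asym : Asymmetric E) (trans : Transitive E) where

  open Closure E
  open StrictOrder E E? asym trans
  private
    module Dual = StrictOrder (flip E) (flip E?) asym
                    (λ a b c b<a c<b a≢c → trans c b a c<b b<a (a≢c ∘ sym))

  ~-overlap⇒overlap : ∀ {M M'} → IsModule E M → IsModule _~_ M' → Overlap _~_ M M' →
    ∃ λ N → IsModule E N × Overlap E M N
  ~-overlap⇒overlap {M} {M'} M-mod M'~ ((i₀ , i₀∈M , i₀∈M') , M⊈M' , M'⊈M)
    with ⊈-witness M⊈M' | ⊈-witness M'⊈M
  ... | r₀ , r₀∈M , r₀∉M' | d₀ , d₀∈M' , d₀∉M with d₀ ~? i₀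
  ...   | no d₀≁i₀ =
    hull M' , hull-module M'~ ,
    Overlapping.apart⇒hull-overlaps M-mod M'~ i₀∈M i₀∈M' r₀∈M r₀∉M' d₀∈M' d₀∉M d₀≁i₀
  ...   | yes (inj₂ i₀<d₀) =
    Overlapping.below⇒overlap M-mod M'~ i₀∈M i₀∈M' r₀∈M r₀∉M' d₀∈M' d₀∉M i₀<d₀
  ...   | yes (inj₁ d₀<i₀)
    with Dual.Overlapping.below⇒overlap (module-flip M-mod) (module-flip M'~)
           i₀∈M i₀∈M' r₀∈M r₀∉M' d₀∈M' d₀∉M d₀<i₀
  ...     | N , N-mod , M-overlaps-N = N , module-flip N-mod , M-overlaps-N

  strong-module⇒strong-~-module : ∀ {M} → IsStrongModule E M → IsStrongModule _~_ M
  strong-module⇒strong-~-module (M-mod , strong) = module⇒~-module M-mod , λ M' M'~ M-overlaps-M' →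
    let N , N-mod , M-overlaps-N = ~-overlap⇒overlap M-mod M'~ M-overlaps-M'
    in strong N N-mod M-overlaps-N

  strong-~-module⇒strong-module : ∀ {M} → IsStrongModule _~_ M → IsStrongModule E M
  strong-~-module⇒strong-module (M~ , ~-strong) =
    unmixed-~-module⇒module M~ unmixed , λ N → ~-strong N ∘ module⇒~-module
    where
    unmixed : ∀ {x a b} → x ∉ _ → a ∈ _ → b ∈ _ → E x a → ¬ E b x
    unmixed x∉ a∈ b∈ x<a b<x =
      let N , N~ , M-overlaps-N = mixed⇒overlap M~ x∉ a∈ b∈ x<a b<x
      in ~-strong N N~ M-overlaps-N

theorem1 : (n : ℕ) (E : Graph n) → Decidable E → Loopless E →
    Transitive E → Acyclic E → (M : Subset n) →
    IsStrongModule E M ⇔ IsStrongModule (UndirectedClosure E) M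
theorem1 n E E? _ trans acyclic M =
  mk⇔ strong-module⇒strong-~-module strong-~-module⇒strong-module
  where
  asym : Asymmetric E
  asym x<y y<x = acyclic _ (x<y ∷ [ y<x ])
  open Comparability E? asym trans
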